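{- Let $p$ be a prime. A subset $A\subseteq\mathbb{F}_p$ with $A-A\doteq\mathcal{R}_p$ exists if and only if $p=2n(n-1)+1$ for some integer $n$ and there is an algebraic integer $\alpha\in\mathcal{O}$ such that $|\alpha|^2=n+\rho$ and $\operatorname{tr}(\alpha\zeta^{ -k})\in\{ -n,p-n\}$ for every integer $k$.
   Context: $\mathcal{R}_p$ is the set of non-zero quadratic residues modulo $p$; $A-A\doteq\mathcal{R}_p$ means every element of $\mathcal{R}_p$ has exactly one representation as $a'-a''$ with $a',a''\in A$ and every difference $a'-a''$ with $a'\ne a''$ in $A$ lies in $\mathcal{R}_p$. $\zeta$ is a fixed primitive $p$-th root of unity, $\mathbb{K}=\mathbb{Q}(\zeta)$ is the $p$-th cyclotomic field, $\mathcal{O}$ its ring of integers, $\rho:=(\sqrt p-1)/2$ with $\sqrt p$ the positive square root, $|\cdot|$ the complex absolute value, and $\operatorname{tr}$ the trace from $\mathbb{K}$ to $\mathbb{Q}$. -}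

module Defs where

open import Data.Nat as ℕ using (ℕ; NonZero)
open import Data.Integer as ℤ using (ℤ; +_; _-_; _*_; -_; _%ℕ_)
open import Data.Integer.DivMod using (n%ℕd<d)
open import Data.Fin using (Fin; toℕ; fromℕ<)
open import Data.Fin.Subset using (Subset; _∈_)
open import Data.Fin.Properties using (_≟_)
open import Data.Bool using (Bool; true; false; T; not; _∧_)
open import Data.List using (List; foldr; map)
open import Data.Bool.ListAction using (any)
open import Data.List using () renaming (allFin to allFinL)
open import Data.Product using (Σ; _×_; _,_; ∃-syntax)
open import Relation.Nullary using (¬_)
open import Relation.Nullary.Decidable using (⌊_⌋)
open import Relation.Binary.PropositionalEquality using (_≡_)

module _ (p : ℕ) .{{_ : NonZero p}} where

  [_]ₚ : ℤ → Fin p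
  [ k ]ₚ = fromℕ< (n%ℕd<d k p)

  _−ₚ_ : Fin p → Fin p → Fin p
  a −ₚ b = [ + toℕ a - + toℕ b ]ₚ

  isQR : Fin p → Bool
  isQR r = not ⌊ r ≟ [ + 0 ]ₚ ⌋
         ∧ any (λ x → ⌊ [ + toℕ x * + toℕ x ]ₚ ≟ r ⌋) (allFinL p)

  InR : Fin p → Set
  InR r = T (isQR r)

  DiffSetIsQR : Subset p → Set
  DiffSetIsQR A =
      (∀ a′ a″ → a′ ∈ A → a″ ∈ A → ¬ a′ ≡ a″ → InR (a′ −ₚ a″))
    × (∀ r → InR r →
         Σ (Fin p × Fin p) λ { (a′ , a″) →
           (a′ ∈ A × a″ ∈ A × (a′ −ₚ a″) ≡ r)
           × (∀ b′ b″ → b′ ∈ A → b″ ∈ A → (b′ −ₚ b″) ≡ r →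
                (b′ , b″) ≡ (a′ , a″)) })

-- The ring of integers 𝒪 = ℤ[ζ] of ℚ(ζ), ζ a primitive p-th root of 1.
-- An element Σ_i c_i ζ^i is represented by its coefficient vector
-- c : Fin p → ℤ.  Since the only ℤ-linear relation among
-- 1, ζ, …, ζ^{p-1} is 1 + ζ + … + ζ^{p-1} = 0, two vectors represent
-- the same element iff they differ by a constant vector.

  𝒪 : Set
  𝒪 = Fin p → ℤ

  _≈𝒪_ : 𝒪 → 𝒪 → Set
  x ≈𝒪 y = ∃[ c ] (∀ i → x i ≡ y i ℤ.+ c)

  sumℤ : (Fin p → ℤ) → ℤ
  sumℤ f = foldr ℤ._+_ (+ 0) (map f (allFinL p))

  -- product: ζ^i ζ^j = ζ^{i+j mod p}
  _*𝒪_ : 𝒪 → 𝒪 → 𝒪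
  (x *𝒪 y) k = sumℤ (λ i → x i * y (k −ₚ i))

  _+𝒪_ : 𝒪 → 𝒪 → 𝒪
  (x +𝒪 y) k = x k ℤ.+ y k

  int𝒪 : ℤ → 𝒪
  int𝒪 m k = if₀ k
    where
    if₀ : Fin p → ℤ
    if₀ k with k ≟ [ + 0 ]ₚ
    ... | Relation.Nullary.yes _ = m
    ... | Relation.Nullary.no  _ = + 0

  ζ^ : ℤ → 𝒪
  ζ^ k i with i ≟ [ k ]ₚ
  ... | Relation.Nullary.yes _ = + 1
  ... | Relation.Nullary.no  _ = + 0

  -- complex conjugation: ζ^i ↦ ζ^{-i}
  conj : 𝒪 → 𝒪
  conj x i = x ([ + 0 ]ₚ −ₚ i)

  ∣_∣² : 𝒪 → 𝒪
  ∣ α ∣² = α *𝒪 conj α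

  -- trace from ℚ(ζ) to ℚ: tr(ζ^0) = p-1, tr(ζ^i) = -1 for i ≠ 0,
  -- so tr(Σ c_i ζ^i) = p·c_0 − Σ_i c_i.
  tr : 𝒪 → ℤ
  tr x = + p * x [ + 0 ]ₚ - sumℤ x

  -- ρ = (√p − 1)/2 for p ≡ 1 (mod 4), realised in 𝒪 as the Gaussian
  -- period Σ_{r ∈ ℛ_p} ζ^r (Gauss: with ζ = e^{2πi/p} this equals
  -- (√p − 1)/2, √p the positive root).
  ρ : 𝒪
  ρ i with isQR i
  ... | true  = + 1
  ... | false = + 0

{-# OPTIONS --safe #-}

-- The coefficient of |χ_A|² at k counts the representations k = a′ − a″ with a′, a″ ∈ A, so
-- A − A ≐ ℛₚ says exactly that |χ_A|² = |A| + ρ, while tr(χ_A ζ^{-k}) = p·[k ∈ A] − |A|.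
-- Summing the coefficients of |χ_A|² gives |A|² = |A| + (p − 1)/2, that is p = 2n(n − 1) + 1.
-- Conversely tr(α ζ^{-k}) = p·α_k − Σα, so the trace condition makes α equal to χ_A, for A the
-- set where the trace is p − n, up to a constant vector; constant vectors are 0 in 𝒪. Hence
-- |χ_A|² = n + ρ + c for an integer c, and the counts |A| = n + c and |A|² = n + n(n − 1) + pc
-- force c = 0 or |A| = p − n. In the latter case the complement, whose indicator is −χ_A up to
-- a constant, satisfies the same norm condition and has size n ≠ p − n (p is odd), so for it
-- c = 0.

module Submission where

open import Defs
open import Data.Nat as ℕ using (ℕ; NonZero; zero; suc)
import Data.Nat.Properties as ℕP
open import Data.Nat.Primality using (Prime; euclidsLemma; prime⇒nonTrivial)
import Data.Nat.Divisibility as ℕ∣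
import Data.Nat.DivMod as ℕDM
open import Data.Integer as ℤ using (ℤ; +_; _+_; _*_; _-_; -_; _≤_; _%ℕ_; _/ℕ_)
import Data.Integer.Properties as ℤP
open import Data.Integer.DivMod using (n%ℕd<d; a≡a%ℕn+[a/ℕn]*n)
open import Data.Integer.Divisibility.Signed using (_∣_; divides; ∣⇒∣ᵤ; ∣ᵤ⇒∣; ∣m∣n⇒∣m+n; ∣m∣n⇒∣m-n; ∣m⇒∣-m; ∣m⇒∣m*n)
open import Data.Integer.Tactic.RingSolver using (solve-∀)
open import Algebra.Properties.Semiring.Sum ℤP.+-*-semiring
  using (sum; sum-cong-≗; ∑-distrib-+; ∑-comm; sum-permute; sum-remove; *-distribˡ-sum; *-distribʳ-sum)
open import Data.Fin as Fin using (Fin; toℕ; punchIn)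
import Data.Fin.Properties as FinP
open import Data.Fin.Permutation using (permutation)
open import Data.Fin.Subset using (Subset; _∈_; ∁)
open import Data.Vec using (lookup; tabulate)
import Data.Vec.Properties as VecP
import Data.List as List
import Data.List.Properties as ListP
open import Data.Bool using (Bool; true; false; T; not; _∧_)
import Data.Bool.Properties as BoolP
open import Data.Product as Product using (Σ; ∃; ∃-syntax; _×_; _,_; proj₁; proj₂)
open import Data.Sum as Sum using (_⊎_; inj₁; inj₂; [_,_]′)
open import Data.Empty using (⊥; ⊥-elim)
open import Data.Unit using (tt)
open import Data.List.Relation.Unary.Any using (satisfied)
import Data.List.Relation.Unary.Any.Properties as AnyP
open import Data.List.Membership.Propositional using (lose)
open import Data.List.Membership.Propositional.Properties using (∈-allFin)
open import Function using (_∘_; _$_)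
open import Function.Bundles using (_⇔_; mk⇔; Equivalence)
open import Relation.Nullary using (¬_; yes; no; Dec; does)
open import Relation.Nullary.Decidable using (⌊_⌋; toWitness; fromWitness)
open import Relation.Binary.PropositionalEquality
  using (_≡_; _≢_; refl; sym; trans; cong; cong₂; subst; module ≡-Reasoning)

2*x≢1 : ∀ x → + 2 * x ≢ + 1
2*x≢1 x eq with ℕP.m*n≡1⇒m≡1 2 ℤ.∣ x ∣ (trans (sym (ℤP.abs-* (+ 2) x)) (cong ℤ.∣_∣ eq))
... | ()

2n[n-1]+1≢2x : ∀ n x → + 2 * n * (n - + 1) + + 1 ≢ + 2 * x
2n[n-1]+1≢2x n x eq = 2*x≢1 (x - n * (n - + 1)) (begin
  + 2 * (x - n * (n - + 1))                         ≡⟨ lemma n x ⟩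
  + 2 * x - (+ 2 * n * (n - + 1) + + 1) + + 1       ≡⟨ cong (λ y → + 2 * x - y + + 1) eq ⟩
  + 2 * x - + 2 * x + + 1                           ≡⟨ cong (_+ + 1) (ℤP.+-inverseʳ (+ 2 * x)) ⟩
  + 1                                               ∎)
  where open ≡-Reasoning
        lemma : ∀ n x → + 2 * (x - n * (n - + 1)) ≡ + 2 * x - (+ 2 * n * (n - + 1) + + 1) + + 1
        lemma = solve-∀

P≡2n[n-1]+1 : ∀ {n S P} → n * n ≡ n + S → + 2 * S ≡ P - + 1 → P ≡ + 2 * n * (n - + 1) + + 1
P≡2n[n-1]+1 {n} {S} {P} n²≡n+S 2S≡P-1 = begin
  P                              ≡⟨ lemma₁ P ⟩
  (P - + 1) + + 1                ≡⟨ cong (_+ + 1) 2S≡P-1 ⟨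
  + 2 * S + + 1                  ≡⟨ cong (λ y → + 2 * y + + 1) (lemma₂ n S) ⟩
  + 2 * ((n + S) - n) + + 1      ≡⟨ cong (λ y → + 2 * (y - n) + + 1) n²≡n+S ⟨
  + 2 * (n * n - n) + + 1        ≡⟨ lemma₃ n ⟩
  + 2 * n * (n - + 1) + + 1      ∎
  where open ≡-Reasoning
        lemma₁ : ∀ P → P ≡ (P - + 1) + + 1
        lemma₁ = solve-∀
        lemma₂ : ∀ n S → S ≡ (n + S) - n
        lemma₂ = solve-∀
        lemma₃ : ∀ n → + 2 * (n * n - n) + + 1 ≡ + 2 * n * (n - + 1) + + 1
        lemma₃ = solve-∀

c≡0⊎n+c≡P-n : ∀ n c P → (n + c) * (n + c) ≡ n + n * (n - + 1) + P * c → c ≡ + 0 ⊎ n + c ≡ P - n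
c≡0⊎n+c≡P-n n c P eq = Sum.map₂ n+c≡P-n (ℤP.i*j≡0⇒i≡0∨j≡0 c factored)
  where
  lemma₁ : ∀ n c P → c * (c + + 2 * n - P) ≡ (n + c) * (n + c) - (n + n * (n - + 1) + P * c)
  lemma₁ = solve-∀
  lemma₂ : ∀ n c P → n + c ≡ (c + + 2 * n - P) + (P - n)
  lemma₂ = solve-∀
  factored : c * (c + + 2 * n - P) ≡ + 0
  factored = trans (lemma₁ n c P) (trans (cong (_- rhs) eq) (ℤP.+-inverseʳ rhs))
    where rhs = n + n * (n - + 1) + P * c
  n+c≡P-n : c + + 2 * n - P ≡ + 0 → n + c ≡ P - n
  n+c≡P-n e = trans (lemma₂ n c P) (trans (cong (_+ (P - n)) e) (ℤP.+-identityˡ (P - n)))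

prime≤2⇒≡2 : ∀ {q} → Prime q → q ℕ.≤ 2 → q ≡ 2
prime≤2⇒≡2 {q} q-prime q≤2 = ℕP.≤-antisym q≤2 (ℕ.nonTrivial⇒n>1 q {{prime⇒nonTrivial q-prime}})

-- Finite sums over Fin n

sum-const : ∀ n c → sum {n} (λ _ → c) ≡ + n * c
sum-const zero    c = refl
sum-const (suc n) c = trans (cong (_+_ c) (sum-const n c)) (lemma c (+ n))
  where lemma : ∀ c m → c + m * c ≡ (+ 1 + m) * c
        lemma = solve-∀

sum-zero : ∀ {n} {f : Fin n → ℤ} → (∀ i → f i ≡ + 0) → sum f ≡ + 0
sum-zero {n} f≡0 = trans (sum-cong-≗ f≡0) (trans (sum-const n (+ 0)) (ℤP.*-zeroʳ (+ n)))

sum-select : ∀ {n} {f : Fin n → ℤ} i → (∀ j → j ≢ i → f j ≡ + 0) → sum f ≡ f i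
sum-select {suc n} {f} i off = begin
  sum f                          ≡⟨ sum-remove f ⟩
  f i + sum (f ∘ punchIn i)      ≡⟨ cong (_+_ (f i)) (sum-zero (λ j → off _ (FinP.punchInᵢ≢i i j))) ⟩
  f i + + 0                      ≡⟨ ℤP.+-identityʳ (f i) ⟩
  f i                            ∎
  where open ≡-Reasoning

sum-neg : ∀ {n} (f : Fin n → ℤ) → sum (λ i → - f i) ≡ - sum f
sum-neg f = trans (sum-cong-≗ (λ i → sym (ℤP.-1*i≡-i (f i))))
                  (trans (sym (*-distribˡ-sum (- + 1) f)) (ℤP.-1*i≡-i (sum f)))

sum-nonneg : ∀ {n} {f : Fin n → ℤ} → (∀ i → + 0 ≤ f i) → + 0 ≤ sum f
sum-nonneg {zero}  f≥0 = ℤP.≤-refl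
sum-nonneg {suc n} f≥0 = ℤP.+-mono-≤ (f≥0 Fin.zero) (sum-nonneg (f≥0 ∘ Fin.suc))

term≤sum : ∀ {n} {f : Fin n → ℤ} → (∀ i → + 0 ≤ f i) → ∀ i → f i ≤ sum f
term≤sum {suc n} {f} f≥0 i = begin
  f i                         ≡⟨ ℤP.+-identityʳ (f i) ⟨
  f i + + 0                   ≤⟨ ℤP.+-monoʳ-≤ (f i) (sum-nonneg (f≥0 ∘ punchIn i)) ⟩
  f i + sum (f ∘ punchIn i)   ≡⟨ sum-remove f ⟨
  sum f                       ∎
  where open ℤP.≤-Reasoning

two-terms≤sum : ∀ {n} {f : Fin n → ℤ} → (∀ i → + 0 ≤ f i) → ∀ {i j} → i ≢ j → f i + f j ≤ sum f
two-terms≤sum {suc n} {f} f≥0 {i} {j} i≢j = begin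
  f i + f j                                         ≡⟨ cong (λ k → f i + f k) (FinP.punchIn-punchOut i≢j) ⟨
  f i + f (punchIn i (Fin.punchOut i≢j))            ≤⟨ ℤP.+-monoʳ-≤ (f i) (term≤sum (f≥0 ∘ punchIn i) _) ⟩
  f i + sum (f ∘ punchIn i)                         ≡⟨ sum-remove f ⟨
  sum f                                             ∎
  where open ℤP.≤-Reasoning

sum-reindex : ∀ {n} (σ τ : Fin n → Fin n) → (∀ x → σ (τ x) ≡ x) → (∀ x → τ (σ x) ≡ x) →
              (f : Fin n → ℤ) → sum (f ∘ σ) ≡ sum f
sum-reindex σ τ στ τσ f = sym (sum-permute f (permutation σ τ στ τσ))

foldr-+-tabulate : ∀ {n} (f : Fin n → ℤ) → List.foldr _+_ (+ 0) (List.tabulate f) ≡ sum f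
foldr-+-tabulate {zero}  f = refl
foldr-+-tabulate {suc n} f = cong (_+_ (f Fin.zero)) (foldr-+-tabulate (f ∘ Fin.suc))

𝟙 : Bool → ℤ
𝟙 true  = + 1
𝟙 false = + 0

𝟙-nonneg : ∀ x → + 0 ≤ 𝟙 x
𝟙-nonneg true  = ℤ.+≤+ ℕ.z≤n
𝟙-nonneg false = ℤ.+≤+ ℕ.z≤n

𝟙-∧ : ∀ x y → 𝟙 (x ∧ y) ≡ 𝟙 x * 𝟙 y
𝟙-∧ true  y = sym (ℤP.*-identityˡ (𝟙 y))
𝟙-∧ false y = refl

𝟙-not : ∀ x → 𝟙 (not x) ≡ + 1 - 𝟙 x
𝟙-not true  = refl
𝟙-not false = refl

𝟙-T : ∀ {x} → T x → 𝟙 x ≡ + 1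
𝟙-T {true} _ = refl

𝟙-¬T : ∀ {x} → ¬ T x → 𝟙 x ≡ + 0
𝟙-¬T {true}  ¬t = ⊥-elim (¬t tt)
𝟙-¬T {false} _  = refl

1≤𝟙⇒T : ∀ {x} → + 1 ≤ 𝟙 x → T x
1≤𝟙⇒T {true}  _         = tt
1≤𝟙⇒T {false} (ℤ.+≤+ ())

count : ∀ {n} → (Fin n → Bool) → ℤ
count b = sum (𝟙 ∘ b)

count≡0 : ∀ {n} {b : Fin n → Bool} → (∀ i → ¬ T (b i)) → count b ≡ + 0
count≡0 none = sum-zero (𝟙-¬T ∘ none)

count≡1 : ∀ {n} {b : Fin n → Bool} i → T (b i) → (∀ j → T (b j) → j ≡ i) → count b ≡ + 1
count≡1 {b = b} i bi unique = trans (sum-select i off) (𝟙-T bi)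
  where off : ∀ j → j ≢ i → 𝟙 (b j) ≡ + 0
        off j j≢i = 𝟙-¬T (j≢i ∘ unique j)

count-pos : ∀ {n} {b : Fin n → Bool} {i} → T (b i) → + 1 ≤ count b
count-pos {b = b} {i} bi = subst (_≤ count b) (𝟙-T bi) (term≤sum (𝟙-nonneg ∘ b) i)

count≢0⇒∃ : ∀ {n} {b : Fin n → Bool} → count b ≢ + 0 → ∃ λ i → T (b i)
count≢0⇒∃ {b = b} count≢0 with FinP.any? (λ i → BoolP.T? (b i))
... | yes witness = witness
... | no  none    = ⊥-elim (count≢0 (count≡0 (λ i bi → none (i , bi))))

count≡1⇒unique : ∀ {n} {b : Fin n → Bool} → count b ≡ + 1 → ∀ {i j} → T (b i) → T (b j) → i ≡ j
count≡1⇒unique {b = b} count≡one {i} {j} bi bj with i FinP.≟ j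
... | yes i≡j = i≡j
... | no  i≢j = ⊥-elim (2≰1 (begin
  + 1 + + 1         ≡⟨ cong₂ _+_ (𝟙-T bi) (𝟙-T bj) ⟨
  𝟙 (b i) + 𝟙 (b j) ≤⟨ two-terms≤sum (𝟙-nonneg ∘ b) i≢j ⟩
  count b           ≡⟨ count≡one ⟩
  + 1               ∎))
  where open ℤP.≤-Reasoning
        2≰1 : ¬ (+ 1 + + 1 ≤ + 1)
        2≰1 (ℤ.+≤+ (ℕ.s≤s ()))

count-≟ : ∀ {n} (i : Fin n) → count (λ j → ⌊ j FinP.≟ i ⌋) ≡ + 1
count-≟ i = count≡1 i (fromWitness {a? = i FinP.≟ i} refl) (λ j → toWitness)

χ : ∀ {n} → Subset n → Fin n → ℤ
χ E i = 𝟙 (lookup E i)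

size : ∀ {n} → Subset n → ℤ
size E = sum (χ E)

∈⇒T : ∀ {n} {E : Subset n} {i} → i ∈ E → T (lookup E i)
∈⇒T i∈E = Equivalence.from BoolP.T-≡ (VecP.[]=⇒lookup i∈E)

T⇒∈ : ∀ {n} {E : Subset n} {i} → T (lookup E i) → i ∈ E
T⇒∈ {E = E} {i} t = VecP.lookup⇒[]= i E (Equivalence.to BoolP.T-≡ t)

χ-tabulate : ∀ {n} (b : Fin n → Bool) i → χ (tabulate b) i ≡ 𝟙 (b i)
χ-tabulate b i = cong 𝟙 (VecP.lookup∘tabulate b i)

χ-∁ : ∀ {n} (E : Subset n) i → χ (∁ E) i ≡ + 1 - χ E i
χ-∁ E i = trans (cong 𝟙 (VecP.lookup-map i not E)) (𝟙-not (lookup E i))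

size-∁ : ∀ {n} (E : Subset n) → size (∁ E) ≡ + n - size E
size-∁ {n} E = begin
  size (∁ E)                                 ≡⟨ sum-cong-≗ (χ-∁ E) ⟩
  sum (λ i → + 1 - χ E i)                    ≡⟨ ∑-distrib-+ (λ _ → + 1) (λ i → - χ E i) ⟩
  sum {n} (λ _ → + 1) + sum (λ i → - χ E i)
    ≡⟨ cong₂ _+_ (trans (sum-const n (+ 1)) (ℤP.*-identityʳ (+ n))) (sum-neg (χ E)) ⟩
  + n - size E                               ∎
  where open ≡-Reasoning

-- Residues modulo p

module _ (p : ℕ) .{{_ : NonZero p}} where

  ι : Fin p → ℤ
  ι a = + toℕ a

  [_] : ℤ → Fin p
  [_] = [_]ₚ p

  infixl 6 _−_
  _−_ : Fin p → Fin p → Fin p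
  _−_ = _−ₚ_ p

  0ₚ : Fin p
  0ₚ = [ + 0 ]

  p∣x-ι[x] : ∀ x → + p ∣ x - ι [ x ]
  p∣x-ι[x] x = divides (x /ℕ p) (begin
    x - ι [ x ]                           ≡⟨ cong (λ m → x - + m) (FinP.toℕ-fromℕ< (n%ℕd<d x p)) ⟩
    x - + r                               ≡⟨ cong (_- + r) (a≡a%ℕn+[a/ℕn]*n x p) ⟩
    (+ r + (x /ℕ p) * + p) - + r          ≡⟨ lemma (+ r) _ ⟩
    (x /ℕ p) * + p                        ∎)
    where open ≡-Reasoning
          r = x %ℕ p
          lemma : ∀ a b → (a + b) - a ≡ b
          lemma = solve-∀

  residue-unique : ∀ {r s} → r ℕ.< p → s ℕ.< p → + p ∣ + r - + s → r ≡ s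
  residue-unique {r} {s} r<p s<p p∣r-s = ℤP.+-injective (ℤP.i-j≡0⇒i≡j (+ r) (+ s) r-s≡0)
    where
    p∣d : p ℕ∣.∣ ℤ.∣ + r - + s ∣
    p∣d = ∣⇒∣ᵤ p∣r-s
    d<p : ℤ.∣ + r - + s ∣ ℕ.< p
    d<p = ℕP.≤-trans (ℕ.s≤s (subst (ℕ._≤ r ℕ.⊔ s) (cong ℤ.∣_∣ (sym (ℤP.[+m]-[+n]≡m⊖n r s)))
                                   (ℤP.∣m⊝n∣≤m⊔n r s)))
                     (ℕP.⊔-lub r<p s<p)
    r-s≡0 : + r - + s ≡ + 0
    r-s≡0 with ℤ.∣ + r - + s ∣ in eq
    ... | zero  = ℤP.∣i∣≡0⇒i≡0 eq
    ... | suc d = ⊥-elim (ℕ∣.>⇒∤ (subst (ℕ._< p) eq d<p) (subst (p ℕ∣.∣_) eq p∣d))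

  ι-injective-mod : ∀ {a b} → + p ∣ ι a - ι b → a ≡ b
  ι-injective-mod {a} {b} = FinP.toℕ-injective ∘ residue-unique (FinP.toℕ<n a) (FinP.toℕ<n b)

  []-cong-mod : ∀ x y → + p ∣ x - y → [ x ] ≡ [ y ]
  []-cong-mod x y p∣x-y = ι-injective-mod $ subst (+ p ∣_) (lemma x y (ι [ x ]) (ι [ y ])) $
    ∣m∣n⇒∣m+n (∣m∣n⇒∣m-n p∣x-y (p∣x-ι[x] x)) (p∣x-ι[x] y)
    where lemma : ∀ x y u v → (x - y) - (x - u) + (y - v) ≡ u - v
          lemma = solve-∀

  []-injective-mod : ∀ x y → [ x ] ≡ [ y ] → + p ∣ x - y
  []-injective-mod x y [x]≡[y] = subst (+ p ∣_) (lemma x y (ι [ y ])) $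
    subst (λ u → + p ∣ (x - u) - (y - ι [ y ])) (cong ι [x]≡[y]) (∣m∣n⇒∣m-n (p∣x-ι[x] x) (p∣x-ι[x] y))
    where lemma : ∀ x y v → (x - v) - (y - v) ≡ x - y
          lemma = solve-∀

  [ι] : ∀ a → [ ι a ] ≡ a
  [ι] a = ι-injective-mod (subst (+ p ∣_) (lemma (ι a) (ι [ ι a ])) (∣m⇒∣-m (p∣x-ι[x] (ι a))))
    where lemma : ∀ x u → - (x - u) ≡ u - x
          lemma = solve-∀

  -- With [ι], this reduces identities in 𝔽ₚ to ring identities in ℤ.
  []-− : ∀ x y → [ x ] − [ y ] ≡ [ x - y ]
  []-− x y = []-cong-mod (ι [ x ] - ι [ y ]) (x - y) (subst (+ p ∣_) (lemma x y (ι [ x ]) (ι [ y ]))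
    (∣m∣n⇒∣m-n (p∣x-ι[x] y) (p∣x-ι[x] x)))
    where lemma : ∀ x y u v → (y - v) - (x - u) ≡ (u - v) - (x - y)
          lemma = solve-∀

  −-[] : ∀ a y → a − [ y ] ≡ [ ι a - y ]
  −-[] a y = trans (cong (_− [ y ]) (sym ([ι] a))) ([]-− (ι a) y)

  []−ι : ∀ x a → [ x ] − a ≡ [ x - ι a ]
  []−ι x a = trans (cong ([ x ] −_) (sym ([ι] a))) ([]-− x (ι a))

  a−[a−b]≡b : ∀ a b → a − (a − b) ≡ b
  a−[a−b]≡b a b = begin
    a − [ ι a - ι b ]       ≡⟨ −-[] a (ι a - ι b) ⟩
    [ ι a - (ι a - ι b) ]   ≡⟨ cong [_] (lemma (ι a) (ι b)) ⟩
    [ ι b ]                 ≡⟨ [ι] b ⟩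
    b                       ∎
    where open ≡-Reasoning
          lemma : ∀ x y → x - (x - y) ≡ y
          lemma = solve-∀

  a−b≡c⇒a−c≡b : ∀ {a b c} → a − b ≡ c → a − c ≡ b
  a−b≡c⇒a−c≡b {a} {b} a−b≡c = trans (cong (a −_) (sym a−b≡c)) (a−[a−b]≡b a b)

  a−b≡0⇒a≡b : ∀ {a b} → a − b ≡ 0ₚ → a ≡ b
  a−b≡0⇒a≡b {a} {b} a−b≡0 =
    ι-injective-mod (subst (+ p ∣_) (ℤP.+-identityʳ (ι a - ι b)) ([]-injective-mod (ι a - ι b) (+ 0) a−b≡0))

  a−a≡0 : ∀ a → a − a ≡ 0ₚ
  a−a≡0 a = cong [_] (ℤP.+-inverseʳ (ι a))

  a−0≡a : ∀ a → a − 0ₚ ≡ a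
  a−0≡a a = trans (−-[] a (+ 0)) (trans (cong [_] (ℤP.+-identityʳ (ι a))) ([ι] a))

  0−[a−b]≡b−a : ∀ a b → 0ₚ − (a − b) ≡ b − a
  0−[a−b]≡b−a a b = trans ([]-− (+ 0) (ι a - ι b)) (cong [_] (lemma (ι a) (ι b)))
    where lemma : ∀ x y → + 0 - (x - y) ≡ y - x
          lemma = solve-∀

  0−[-x]≡[x] : ∀ x → 0ₚ − [ - x ] ≡ [ x ]
  0−[-x]≡[x] x = trans ([]-− (+ 0) (- x)) (cong [_] (lemma x))
    where lemma : ∀ x → + 0 - (- x) ≡ x
          lemma = solve-∀

  [a−b]−[0−b]≡a : ∀ a b → (a − b) − (0ₚ − b) ≡ a
  [a−b]−[0−b]≡a a b = begin
    (a − b) − (0ₚ − b)                  ≡⟨ cong ((a − b) −_) ([]−ι (+ 0) b) ⟩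
    [ ι a - ι b ] − [ + 0 - ι b ]       ≡⟨ []-− (ι a - ι b) (+ 0 - ι b) ⟩
    [ (ι a - ι b) - (+ 0 - ι b) ]       ≡⟨ cong [_] (lemma (ι a) (ι b)) ⟩
    [ ι a ]                             ≡⟨ [ι] a ⟩
    a                                   ∎
    where open ≡-Reasoning
          lemma : ∀ x y → (x - y) - (+ 0 - y) ≡ x
          lemma = solve-∀

  [a−[0−b]]−b≡a : ∀ a b → (a − (0ₚ − b)) − b ≡ a
  [a−[0−b]]−b≡a a b = begin
    (a − (0ₚ − b)) − b                  ≡⟨ cong (λ c → (a − c) − b) ([]−ι (+ 0) b) ⟩
    (a − [ + 0 - ι b ]) − b             ≡⟨ cong (_− b) (−-[] a (+ 0 - ι b)) ⟩
    [ ι a - (+ 0 - ι b) ] − b           ≡⟨ []−ι (ι a - (+ 0 - ι b)) b ⟩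
    [ ι a - (+ 0 - ι b) - ι b ]         ≡⟨ cong [_] (lemma (ι a) (ι b)) ⟩
    [ ι a ]                             ≡⟨ [ι] a ⟩
    a                                   ∎
    where open ≡-Reasoning
          lemma : ∀ x y → x - (+ 0 - y) - y ≡ x
          lemma = solve-∀

  sum-shift : ∀ (f : Fin p → ℤ) k → sum (λ i → f (i − k)) ≡ sum f
  sum-shift f k =
    sum-reindex (_− k) (_− (0ₚ − k)) (λ j → [a−[0−b]]−b≡a j k) (λ i → [a−b]−[0−b]≡a i k) f

  sum-reflect : ∀ (f : Fin p → ℤ) a → sum (λ i → f (a − i)) ≡ sum f
  sum-reflect f a = sum-reindex (a −_) (a −_) (a−[a−b]≡b a) (a−[a−b]≡b a) f

  -- Coefficient vectors in 𝒪

  sumℤ≡sum : ∀ f → sumℤ p f ≡ sum f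
  sumℤ≡sum f = trans (cong (List.foldr _+_ (+ 0)) (ListP.map-tabulate (λ i → i) f)) (foldr-+-tabulate f)

  ζ^-at : ∀ m → ζ^ p m [ m ] ≡ + 1
  ζ^-at m with [ m ] FinP.≟ [ m ]
  ... | yes _   = refl
  ... | no  m≢m = ⊥-elim (m≢m refl)

  ζ^-off : ∀ {m j} → j ≢ [ m ] → ζ^ p m j ≡ + 0
  ζ^-off {m} {j} j≢m with j FinP.≟ [ m ]
  ... | yes j≡m = ⊥-elim (j≢m j≡m)
  ... | no  _   = refl

  *ζ^ : ∀ x m k → _*𝒪_ p x (ζ^ p m) k ≡ x (k − [ m ])
  *ζ^ x m k = begin
    sumℤ p (λ i → x i * ζ^ p m (k − i))             ≡⟨ sumℤ≡sum _ ⟩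
    sum (λ i → x i * ζ^ p m (k − i))                ≡⟨ sum-select (k − [ m ]) off ⟩
    x (k − [ m ]) * ζ^ p m (k − (k − [ m ]))        ≡⟨ cong (λ j → x (k − [ m ]) * ζ^ p m j) (a−[a−b]≡b k [ m ]) ⟩
    x (k − [ m ]) * ζ^ p m [ m ]                    ≡⟨ cong (x (k − [ m ]) *_) (ζ^-at m) ⟩
    x (k − [ m ]) * + 1                             ≡⟨ ℤP.*-identityʳ _ ⟩
    x (k − [ m ])                                   ∎
    where
    open ≡-Reasoning
    off : ∀ i → i ≢ k − [ m ] → x i * ζ^ p m (k − i) ≡ + 0
    off i i≢k−m = trans (cong (x i *_) (ζ^-off (i≢k−m ∘ sym ∘ a−b≡c⇒a−c≡b))) (ℤP.*-zeroʳ (x i))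

  tr-*ζ^- : ∀ x k → tr p (_*𝒪_ p x (ζ^ p (- k))) ≡ + p * x [ k ] - sum x
  tr-*ζ^- x k = cong₂ (λ a b → + p * a - b)
    (trans (*ζ^ x (- k) 0ₚ) (cong x (0−[-x]≡[x] k)))
    (trans (sumℤ≡sum _) (trans (sum-cong-≗ (*ζ^ x (- k))) (sum-shift x [ - k ])))

  autocorrelation : (Fin p → ℤ) → Fin p → ℤ
  autocorrelation α k = sum (λ i → α i * α (i − k))

  ∣∣²≡autocorrelation : ∀ α k → ∣_∣² p α k ≡ autocorrelation α k
  ∣∣²≡autocorrelation α k =
    trans (sumℤ≡sum _) (sum-cong-≗ (λ i → cong (λ j → α i * α j) (0−[a−b]≡b−a k i)))

  sum-autocorrelation : ∀ α → sum (autocorrelation α) ≡ sum α * sum α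
  sum-autocorrelation α = begin
    sum (λ k → sum (λ i → α i * α (i − k)))     ≡⟨ ∑-comm (λ k i → α i * α (i − k)) ⟩
    sum (λ i → sum (λ k → α i * α (i − k)))     ≡⟨ sum-cong-≗ (λ i → sym (*-distribˡ-sum (α i) (λ k → α (i − k)))) ⟩
    sum (λ i → α i * sum (λ k → α (i − k)))     ≡⟨ sum-cong-≗ (λ i → cong (α i *_) (sum-reflect α i)) ⟩
    sum (λ i → α i * sum α)                     ≡⟨ *-distribʳ-sum (sum α) α ⟨
    sum α * sum α                               ∎
    where open ≡-Reasoning

  autocorrelation-+const : ∀ α β d → (∀ i → α i ≡ β i + d) →
    ∀ k → autocorrelation α k ≡ autocorrelation β k + (d * sum β + d * sum β + + p * (d * d))
  autocorrelation-+const α β d α≡β+d k = begin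
    sum (λ i → α i * α (i − k))
      ≡⟨ sum-cong-≗ (λ i → trans (cong₂ _*_ (α≡β+d i) (α≡β+d (i − k))) (lemma (β i) (β (i − k)) d)) ⟩
    sum (λ i → β i * β (i − k) + (d * β (i − k) + d * β i + d * d))
      ≡⟨ ∑-distrib-+ (λ i → β i * β (i − k)) (λ i → d * β (i − k) + d * β i + d * d) ⟩
    autocorrelation β k + sum (λ i → d * β (i − k) + d * β i + d * d)
      ≡⟨ cong (_+_ (autocorrelation β k)) (trans (∑-distrib-+ (λ i → d * β (i − k) + d * β i) (λ _ → d * d))
                 (cong₂ _+_ (∑-distrib-+ (λ i → d * β (i − k)) (λ i → d * β i)) (sum-const p (d * d)))) ⟩
    autocorrelation β k + (sum (λ i → d * β (i − k)) + sum (λ i → d * β i) + + p * (d * d))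
      ≡⟨ cong (λ s → autocorrelation β k + (s + sum (λ i → d * β i) + + p * (d * d)))
              (trans (sym (*-distribˡ-sum d (λ i → β (i − k)))) (cong (d *_) (sum-shift β k))) ⟩
    autocorrelation β k + (d * sum β + sum (λ i → d * β i) + + p * (d * d))
      ≡⟨ cong (λ s → autocorrelation β k + (d * sum β + s + + p * (d * d))) (*-distribˡ-sum d β) ⟨
    autocorrelation β k + (d * sum β + d * sum β + + p * (d * d))
      ∎
    where open ≡-Reasoning
          lemma : ∀ x y d → (x + d) * (y + d) ≡ x * y + (d * y + d * x + d * d)
          lemma = solve-∀

  autocorrelation-neg : ∀ α k → autocorrelation (λ i → - α i) k ≡ autocorrelation α k
  autocorrelation-neg α k = sum-cong-≗ (λ i → lemma (α i) (α (i − k)))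
    where lemma : ∀ x y → - x * - y ≡ x * y
          lemma = solve-∀

  ≈𝒪-sym : ∀ {x y} → _≈𝒪_ p x y → _≈𝒪_ p y x
  ≈𝒪-sym {x} {y} (c , x≡y+c) = - c , λ i → sym (trans (cong (_+ - c) (x≡y+c i)) (lemma (y i) c))
    where lemma : ∀ a c → a + c + - c ≡ a
          lemma = solve-∀

  ≈𝒪-trans : ∀ {x y z} → _≈𝒪_ p x y → _≈𝒪_ p y z → _≈𝒪_ p x z
  ≈𝒪-trans {x} {y} {z} (c , x≡y+c) (d , y≡z+d) =
    d + c , λ i → trans (x≡y+c i) (trans (cong (_+ c) (y≡z+d i)) (ℤP.+-assoc (z i) d c))

  ∣∣²-cong : ∀ {α β} → _≈𝒪_ p α β → _≈𝒪_ p (∣_∣² p α) (∣_∣² p β)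
  ∣∣²-cong {α} {β} (d , α≡β+d) = _ , λ k → begin
    ∣_∣² p α k                                                  ≡⟨ ∣∣²≡autocorrelation α k ⟩
    autocorrelation α k                                         ≡⟨ autocorrelation-+const α β d α≡β+d k ⟩
    autocorrelation β k + (d * sum β + d * sum β + + p * (d * d)) ≡⟨ cong (_+ _) (∣∣²≡autocorrelation β k) ⟨
    ∣_∣² p β k + (d * sum β + d * sum β + + p * (d * d))          ∎
    where open ≡-Reasoning

  ∣∣²-cong-neg : ∀ {α β} → _≈𝒪_ p α (λ i → - β i) → _≈𝒪_ p (∣_∣² p α) (∣_∣² p β)
  ∣∣²-cong-neg {α} {β} α≈-β =
    ≈𝒪-trans {∣_∣² p α} {∣_∣² p (λ i → - β i)} {∣_∣² p β} (∣∣²-cong {α} {λ i → - β i} α≈-β) (+ 0 , ∣-β∣²≡∣β∣²+0)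
    where
    open ≡-Reasoning
    ∣-β∣²≡∣β∣²+0 : ∀ k → ∣_∣² p (λ i → - β i) k ≡ ∣_∣² p β k + + 0
    ∣-β∣²≡∣β∣²+0 k = begin
      ∣_∣² p (λ i → - β i) k              ≡⟨ ∣∣²≡autocorrelation (λ i → - β i) k ⟩
      autocorrelation (λ i → - β i) k     ≡⟨ autocorrelation-neg β k ⟩
      autocorrelation β k                 ≡⟨ ∣∣²≡autocorrelation β k ⟨
      ∣_∣² p β k                          ≡⟨ ℤP.+-identityʳ (∣_∣² p β k) ⟨
      ∣_∣² p β k + + 0                    ∎

  int𝒪-0 : ∀ n → int𝒪 p n 0ₚ ≡ n
  int𝒪-0 n with 0ₚ FinP.≟ 0ₚ
  ... | yes _   = refl
  ... | no  0≢0 = ⊥-elim (0≢0 refl)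

  int𝒪-≢0 : ∀ n {k} → k ≢ 0ₚ → int𝒪 p n k ≡ + 0
  int𝒪-≢0 n {k} k≢0 with k FinP.≟ 0ₚ
  ... | yes k≡0 = ⊥-elim (k≢0 k≡0)
  ... | no  _   = refl

  sum-int𝒪 : ∀ n → sum (int𝒪 p n) ≡ n
  sum-int𝒪 n = trans (sum-select 0ₚ (λ k → int𝒪-≢0 n)) (int𝒪-0 n)

  ρ≡𝟙∘isQR : ∀ k → ρ p k ≡ 𝟙 (isQR p k)
  ρ≡𝟙∘isQR k with isQR p k
  ... | true  = refl
  ... | false = refl

  sq : Fin p → Fin p
  sq x = [ ι x * ι x ]

  ι-0 : ι 0ₚ ≡ + 0
  ι-0 = cong +_ (trans (FinP.toℕ-fromℕ< (n%ℕd<d (+ 0) p)) (ℕDM.m*n%n≡0 0 p))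

  sq-0 : sq 0ₚ ≡ 0ₚ
  sq-0 = cong (λ x → [ x * x ]) ι-0

  InR⇔ : ∀ {r} → InR p r ⇔ (r ≢ 0ₚ × ∃ λ x → sq x ≡ r)
  InR⇔ {r} = mk⇔
    (λ r∈R → let r≢0 , ∃x = Equivalence.to BoolP.T-∧ r∈R in
      (λ r≡0 → T-not-≟ r≢0 r≡0) ,
      Product.map₂ toWitness (satisfied (AnyP.any⁻ _ (List.allFin p) ∃x)))
    (λ (r≢0 , x , sqx≡r) → Equivalence.from BoolP.T-∧
      ( ¬T-≟ r≢0
      , AnyP.any⁺ _ (lose (∈-allFin x) (fromWitness sqx≡r))))
    where
    T-not-≟ : ∀ {a b : Fin p} → T (not ⌊ a FinP.≟ b ⌋) → a ≢ b
    T-not-≟ {a} {b} t a≡b with a FinP.≟ b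
    ... | yes _   = t
    ... | no  a≢b = a≢b a≡b
    ¬T-≟ : ∀ {a b : Fin p} → a ≢ b → T (not ⌊ a FinP.≟ b ⌋)
    ¬T-≟ {a} {b} a≢b with a FinP.≟ b
    ... | yes a≡b = a≢b a≡b
    ... | no  _   = tt

  ρ-0 : ρ p 0ₚ ≡ + 0
  ρ-0 = trans (ρ≡𝟙∘isQR 0ₚ) (𝟙-¬T (λ 0∈R → proj₁ (Equivalence.to InR⇔ 0∈R) refl))

  -- Difference sets

  diffRep : Subset p → Fin p → Fin p → Bool
  diffRep E k i = lookup E i ∧ lookup E (i − k)

  autocorrelation-χ : ∀ E k → autocorrelation (χ E) k ≡ count (diffRep E k)
  autocorrelation-χ E k = sum-cong-≗ (λ i → sym (𝟙-∧ (lookup E i) (lookup E (i − k))))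

  autocorrelation-χ-0 : ∀ E → autocorrelation (χ E) 0ₚ ≡ size E
  autocorrelation-χ-0 E = sum-cong-≗ λ i → begin
    χ E i * χ E (i − 0ₚ)                ≡⟨ cong (λ j → χ E i * χ E j) (a−0≡a i) ⟩
    𝟙 (lookup E i) * 𝟙 (lookup E i)     ≡⟨ 𝟙-∧ (lookup E i) (lookup E i) ⟨
    𝟙 (lookup E i ∧ lookup E i)         ≡⟨ cong 𝟙 (BoolP.∧-idem (lookup E i)) ⟩
    χ E i                               ∎
    where open ≡-Reasoning

  diffRep⇒∈ : ∀ {E} k {i} → T (diffRep E k i) → i ∈ E × i − k ∈ E
  diffRep⇒∈ k t = Product.map T⇒∈ T⇒∈ (Equivalence.to BoolP.T-∧ t)

  ∈⇒diffRep : ∀ {E} k {i} → i ∈ E → i − k ∈ E → T (diffRep E k i)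
  ∈⇒diffRep k i∈E i−k∈E = Equivalence.from BoolP.T-∧ (∈⇒T i∈E , ∈⇒T i−k∈E)

  DiffSetIsQR⇒autocorrelation≡ρ : ∀ {E} → DiffSetIsQR p E → ∀ k → k ≢ 0ₚ → autocorrelation (χ E) k ≡ ρ p k
  DiffSetIsQR⇒autocorrelation≡ρ {E} (closed , unique) k k≢0 =
    trans (autocorrelation-χ E k) (trans (count≡ρ (BoolP.T? (isQR p k))) (sym (ρ≡𝟙∘isQR k)))
    where
    count≡ρ : Dec (InR p k) → count (diffRep E k) ≡ 𝟙 (isQR p k)
    count≡ρ (yes k∈R) with unique k k∈R
    ... | (a′ , a″) , (a′∈E , a″∈E , a′−a″≡k) , uniq =
      trans (count≡1 a′ (∈⇒diffRep k a′∈E (subst (_∈ E) (sym (a−b≡c⇒a−c≡b a′−a″≡k)) a″∈E)) rep⇒≡a′)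
            (sym (𝟙-T k∈R))
      where
      rep⇒≡a′ : ∀ j → T (diffRep E k j) → j ≡ a′
      rep⇒≡a′ j t = let j∈E , j−k∈E = diffRep⇒∈ k t in
        cong proj₁ (uniq j (j − k) j∈E j−k∈E (a−[a−b]≡b j k))
    count≡ρ (no k∉R) = trans (count≡0 no-rep) (sym (𝟙-¬T k∉R))
      where
      no-rep : ∀ i → ¬ T (diffRep E k i)
      no-rep i t = let i∈E , i−k∈E = diffRep⇒∈ k t in
        k∉R (subst (InR p) (a−[a−b]≡b i k)
          (closed i (i − k) i∈E i−k∈E (λ i≡i−k → k≢0 (trans (sym (a−[a−b]≡b i k))
                                                     (trans (cong (i −_) (sym i≡i−k)) (a−a≡0 i))))))

  autocorrelation≡ρ⇒DiffSetIsQR : ∀ {E} → (∀ k → k ≢ 0ₚ → autocorrelation (χ E) k ≡ ρ p k) → DiffSetIsQR p E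
  autocorrelation≡ρ⇒DiffSetIsQR {E} N≡ρ = closed , unique
    where
    count≡𝟙 : ∀ k → k ≢ 0ₚ → count (diffRep E k) ≡ 𝟙 (isQR p k)
    count≡𝟙 k k≢0 = trans (sym (autocorrelation-χ E k)) (trans (N≡ρ k k≢0) (ρ≡𝟙∘isQR k))

    closed : ∀ a′ a″ → a′ ∈ E → a″ ∈ E → a′ ≢ a″ → InR p (a′ − a″)
    closed a′ a″ a′∈E a″∈E a′≢a″ = 1≤𝟙⇒T (subst (+ 1 ≤_) (count≡𝟙 k k≢0)
      (count-pos {b = diffRep E k} (∈⇒diffRep k a′∈E (subst (_∈ E) (sym (a−[a−b]≡b a′ a″)) a″∈E))))
      where k = a′ − a″
            k≢0 = a′≢a″ ∘ a−b≡0⇒a≡b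

    unique : ∀ r → InR p r → Σ (Fin p × Fin p) λ { (a′ , a″) →
               (a′ ∈ E × a″ ∈ E × a′ − a″ ≡ r)
               × (∀ b′ b″ → b′ ∈ E → b″ ∈ E → b′ − b″ ≡ r → (b′ , b″) ≡ (a′ , a″)) }
    unique r r∈R = (i , i − r) , (i∈E , i−r∈E , a−[a−b]≡b i r) , uniq
      where
      r≢0 = proj₁ (Equivalence.to InR⇔ r∈R)
      #reps≡1 : count (diffRep E r) ≡ + 1
      #reps≡1 = trans (count≡𝟙 r r≢0) (𝟙-T r∈R)
      rep = count≢0⇒∃ (λ #reps≡0 → 1≢0 (trans (sym #reps≡1) #reps≡0))
        where 1≢0 : + 1 ≢ + 0
              1≢0 ()
      i = proj₁ rep
      i∈E = proj₁ (diffRep⇒∈ r (proj₂ rep))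
      i−r∈E = proj₂ (diffRep⇒∈ r (proj₂ rep))
      uniq : ∀ b′ b″ → b′ ∈ E → b″ ∈ E → b′ − b″ ≡ r → (b′ , b″) ≡ (i , i − r)
      uniq b′ b″ b′∈E b″∈E b′−b″≡r = cong₂ _,_ b′≡i (trans (sym (a−b≡c⇒a−c≡b b′−b″≡r)) (cong (_− r) b′≡i))
        where b′≡i = count≡1⇒unique #reps≡1
                       (∈⇒diffRep r b′∈E (subst (_∈ E) (sym (a−b≡c⇒a−c≡b b′−b″≡r)) b″∈E)) (proj₂ rep)

  DiffSetIsQR⇒-r≢r : ∀ {A} → DiffSetIsQR p A → ∀ {r} → InR p r → 0ₚ − r ≢ r
  DiffSetIsQR⇒-r≢r (_ , unique) {r} r∈R −r≡r with unique r r∈R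
  ... | (a′ , a″) , (a′∈A , a″∈A , a′−a″≡r) , uniq = r≢0 (begin
    r          ≡⟨ a′−a″≡r ⟨
    a′ − a″    ≡⟨ cong (a′ −_) (cong proj₁ swapped) ⟩
    a′ − a′    ≡⟨ a−a≡0 a′ ⟩
    0ₚ         ∎)
    where
    open ≡-Reasoning
    r≢0 = proj₁ (Equivalence.to InR⇔ r∈R)
    swapped : (a″ , a′) ≡ (a′ , a″)
    swapped = uniq a″ a′ a″∈A a′∈A (trans (sym (0−[a−b]≡b−a a′ a″)) (trans (cong (0ₚ −_) a′−a″≡r) −r≡r))

  module _ (E : Subset p) {n c : ℤ} (N≡n+ρ+c : ∀ k → autocorrelation (χ E) k ≡ int𝒪 p n k + ρ p k + c) where

    size≡n+c : size E ≡ n + c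
    size≡n+c = begin
      size E                        ≡⟨ autocorrelation-χ-0 E ⟨
      autocorrelation (χ E) 0ₚ      ≡⟨ N≡n+ρ+c 0ₚ ⟩
      int𝒪 p n 0ₚ + ρ p 0ₚ + c      ≡⟨ cong (_+ c) (cong₂ _+_ (int𝒪-0 n) ρ-0) ⟩
      n + + 0 + c                   ≡⟨ cong (_+ c) (ℤP.+-identityʳ n) ⟩
      n + c                         ∎
      where open ≡-Reasoning

    size²≡n+Σρ+pc : size E * size E ≡ n + sum (ρ p) + + p * c
    size²≡n+Σρ+pc = begin
      size E * size E                                   ≡⟨ sum-autocorrelation (χ E) ⟨
      sum (autocorrelation (χ E))                       ≡⟨ sum-cong-≗ N≡n+ρ+c ⟩
      sum (λ k → int𝒪 p n k + ρ p k + c)                ≡⟨ ∑-distrib-+ (λ k → int𝒪 p n k + ρ p k) (λ _ → c) ⟩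
      sum (λ k → int𝒪 p n k + ρ p k) + sum {p} (λ _ → c) ≡⟨ cong₂ _+_ (∑-distrib-+ (int𝒪 p n) (ρ p)) (sum-const p c) ⟩
      sum (int𝒪 p n) + sum (ρ p) + + p * c              ≡⟨ cong (λ s → s + sum (ρ p) + + p * c) (sum-int𝒪 n) ⟩
      n + sum (ρ p) + + p * c                           ∎
      where open ≡-Reasoning

  NormCondition : ℤ → 𝒪 p → Set
  NormCondition n α = _≈𝒪_ p (∣_∣² p α) (_+𝒪_ p (int𝒪 p n) (ρ p))

  TraceCondition : ℤ → 𝒪 p → Set
  TraceCondition n α = ∀ (k : ℤ) → tr p (_*𝒪_ p α (ζ^ p (- k))) ≡ - n ⊎ tr p (_*𝒪_ p α (ζ^ p (- k))) ≡ + p - n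

  NormCondition-∁ : ∀ {n} E → NormCondition n (χ E) → NormCondition n (χ (∁ E))
  NormCondition-∁ {n} E norm =
    ≈𝒪-trans {∣_∣² p (χ (∁ E))} {∣_∣² p (χ E)} {_+𝒪_ p (int𝒪 p n) (ρ p)}
      (≈𝒪-sym {∣_∣² p (χ E)} {∣_∣² p (χ (∁ E))} (∣∣²-cong-neg {χ E} {χ (∁ E)} χE≈-χ∁E)) norm
    where
    χE≈-χ∁E : _≈𝒪_ p (χ E) (λ i → - χ (∁ E) i)
    χE≈-χ∁E = + 1 , λ i → trans (lemma (χ E i)) (cong (λ t → - t + + 1) (sym (χ-∁ E i)))
      where lemma : ∀ x → x ≡ - (+ 1 - x) + + 1
            lemma = solve-∀

  levelSet : 𝒪 p → ℤ → Subset p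
  levelSet α n = tabulate (λ j → does (+ p * α j - sum α ℤ.≟ + p - n))

  TraceCondition⇒≈χ : ∀ {n α} → TraceCondition n α → _≈𝒪_ p α (χ (levelSet α n))
  TraceCondition⇒≈χ {n} {α} tr≡ = α 0ₚ - χ A 0ₚ , α≡χ+c
    where
    A = levelSet α n
    S = sum α

    coeff : ∀ j → + p * α j - S ≡ - n ⊎ + p * α j - S ≡ + p - n
    coeff j = subst (λ t → t ≡ - n ⊎ t ≡ + p - n)
                    (trans (tr-*ζ^- α (ι j)) (cong (λ i → + p * α i - S) ([ι] j))) (tr≡ (ι j))

    level : ∀ {t} (d : Dec (t ≡ + p - n)) → t ≡ - n ⊎ t ≡ + p - n → t ≡ + p * 𝟙 (does d) - n
    level (yes t≡p-n) _            = trans t≡p-n (cong (_- n) (sym (ℤP.*-identityʳ (+ p))))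
    level (no  _)     (inj₁ t≡-n)  = trans t≡-n (sym (trans (cong (_- n) (ℤP.*-zeroʳ (+ p))) (ℤP.+-identityˡ (- n))))
    level (no  t≢p-n) (inj₂ t≡p-n) = ⊥-elim (t≢p-n t≡p-n)

    p[α-χ]≡S-n : ∀ j → + p * (α j - χ A j) ≡ S - n
    p[α-χ]≡S-n j = begin
      + p * (α j - χ A j)                ≡⟨ lemma (+ p) (α j) (χ A j) S ⟩
      (+ p * α j - S) - + p * χ A j + S  ≡⟨ cong (λ t → t - + p * χ A j + S) (level (+ p * α j - S ℤ.≟ + p - n) (coeff j)) ⟩
      (+ p * 𝟙 _ - n) - + p * χ A j + S  ≡⟨ cong (λ t → (+ p * t - n) - + p * χ A j + S) (χ-tabulate _ j) ⟨
      (+ p * χ A j - n) - + p * χ A j + S ≡⟨ lemma′ (+ p * χ A j) n S ⟩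
      S - n                              ∎
      where open ≡-Reasoning
            lemma : ∀ P a x S → P * (a - x) ≡ (P * a - S) - P * x + S
            lemma = solve-∀
            lemma′ : ∀ y n S → (y - n) - y + S ≡ S - n
            lemma′ = solve-∀

    α≡χ+c : ∀ j → α j ≡ χ A j + (α 0ₚ - χ A 0ₚ)
    α≡χ+c j = trans (lemma (α j) (χ A j))
      (cong (_+_ (χ A j)) (ℤP.*-cancelˡ-≡ (+ p) _ _ (trans (p[α-χ]≡S-n j) (sym (p[α-χ]≡S-n 0ₚ)))))
      where lemma : ∀ a x → a ≡ x + (a - x)
            lemma = solve-∀

  TraceCondition-χ : ∀ A → TraceCondition (size A) (χ A)
  TraceCondition-χ A k =
    subst (λ t → t ≡ - size A ⊎ t ≡ + p - size A) (sym (tr-*ζ^- (χ A) k)) (values (lookup A [ k ]))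
    where
    values : ∀ b → + p * 𝟙 b - size A ≡ - size A ⊎ + p * 𝟙 b - size A ≡ + p - size A
    values true  = inj₂ (cong (_- size A) (ℤP.*-identityʳ (+ p)))
    values false = inj₁ (trans (cong (_- size A) (ℤP.*-zeroʳ (+ p))) (ℤP.+-identityˡ (- size A)))

  DiffSetIsQR⇒autocorrelation≡size+ρ : ∀ {A} → DiffSetIsQR p A →
    ∀ k → autocorrelation (χ A) k ≡ int𝒪 p (size A) k + ρ p k + + 0
  DiffSetIsQR⇒autocorrelation≡size+ρ {A} A−A≐R k = trans (at k (k FinP.≟ 0ₚ)) (sym (ℤP.+-identityʳ _))
    where
    at : ∀ k → Dec (k ≡ 0ₚ) → autocorrelation (χ A) k ≡ int𝒪 p (size A) k + ρ p k
    at .0ₚ (yes refl) = trans (autocorrelation-χ-0 A)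
      (sym (trans (cong₂ _+_ (int𝒪-0 (size A)) ρ-0) (ℤP.+-identityʳ (size A))))
    at k (no k≢0) = trans (DiffSetIsQR⇒autocorrelation≡ρ A−A≐R k k≢0)
      (sym (trans (cong (_+ ρ p k) (int𝒪-≢0 (size A) k≢0)) (ℤP.+-identityˡ (ρ p k))))

  -- Quadratic residues modulo a prime

  module _ (p-prime : Prime p) where

    p∣x*y⇒p∣x⊎p∣y : ∀ x y → + p ∣ x * y → + p ∣ x ⊎ + p ∣ y
    p∣x*y⇒p∣x⊎p∣y x y p∣xy = Sum.map ∣ᵤ⇒∣ ∣ᵤ⇒∣
      (euclidsLemma ℤ.∣ x ∣ ℤ.∣ y ∣ p-prime (subst (p ℕ∣.∣_) (ℤP.abs-* x y) (∣⇒∣ᵤ p∣xy)))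

    p∣ι⇒≡0 : ∀ {x} → + p ∣ ι x → x ≡ 0ₚ
    p∣ι⇒≡0 {x} p∣x =
      trans (sym ([ι] x)) ([]-cong-mod (ι x) (+ 0) (subst (+ p ∣_) (sym (ℤP.+-identityʳ (ι x))) p∣x))

    ≡0−⇔p∣+ : ∀ {x y} → (x ≡ 0ₚ − y) ⇔ (+ p ∣ ι x + ι y)
    ≡0−⇔p∣+ {x} {y} = mk⇔
      (λ x≡−y → subst (+ p ∣_) (lemma (ι x) (ι y)) ([]-injective-mod (ι x) (+ 0 - ι y) (Equivalence.to [ι]x≡[-ιy]⇔ x≡−y)))
      (λ p∣x+y → Equivalence.from [ι]x≡[-ιy]⇔ ([]-cong-mod (ι x) (+ 0 - ι y) (subst (+ p ∣_) (sym (lemma (ι x) (ι y))) p∣x+y)))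
      where
      lemma : ∀ x y → x - (+ 0 - y) ≡ x + y
      lemma = solve-∀
      [ι]x≡[-ιy]⇔ : (x ≡ 0ₚ − y) ⇔ ([ ι x ] ≡ [ + 0 - ι y ])
      [ι]x≡[-ιy]⇔ = mk⇔ (λ x≡−y → trans ([ι] x) (trans x≡−y ([]−ι (+ 0) y)))
                         (λ e → trans (sym ([ι] x)) (trans e (sym ([]−ι (+ 0) y))))

    sq≡sq⇒≡± : ∀ {x y} → sq x ≡ sq y → x ≡ y ⊎ x ≡ 0ₚ − y
    sq≡sq⇒≡± {x} {y} sqx≡sqy = Sum.map ι-injective-mod (Equivalence.from ≡0−⇔p∣+)
      (p∣x*y⇒p∣x⊎p∣y (ι x - ι y) (ι x + ι y) (subst (+ p ∣_) (lemma (ι x) (ι y)) p∣x²-y²))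
      where
      p∣x²-y² = []-injective-mod (ι x * ι x) (ι y * ι y) sqx≡sqy
      lemma : ∀ x y → x * x - y * y ≡ (x - y) * (x + y)
      lemma = solve-∀

    sq-neg : ∀ y → sq (0ₚ − y) ≡ sq y
    sq-neg y = []-cong-mod (ι (0ₚ − y) * ι (0ₚ − y)) (ι y * ι y) (subst (+ p ∣_) (lemma (ι (0ₚ − y)) (ι y))
                 (∣m⇒∣m*n (ι (0ₚ − y) - ι y) (Equivalence.to (≡0−⇔p∣+ {0ₚ − y} {y}) refl)))
      where lemma : ∀ x y → (x + y) * (x - y) ≡ x * x - y * y
            lemma = solve-∀

    sq≡0⇒≡0 : ∀ {x} → sq x ≡ 0ₚ → x ≡ 0ₚ
    sq≡0⇒≡0 {x} sqx≡0 = [ p∣ι⇒≡0 , p∣ι⇒≡0 ]′ (p∣x*y⇒p∣x⊎p∣y (ι x) (ι x) p∣x²)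
      where p∣x² = subst (+ p ∣_) (ℤP.+-identityʳ (ι x * ι x)) ([]-injective-mod (ι x * ι x) (+ 0) sqx≡0)

    ≢0⇒≢−self : p ≢ 2 → ∀ {y} → y ≢ 0ₚ → y ≢ 0ₚ − y
    ≢0⇒≢−self p≢2 {y} y≢0 y≡−y = [ p≢2 ∘ prime≤2⇒≡2 p-prime ∘ ℕ∣.∣⇒≤ ∘ ∣⇒∣ᵤ , y≢0 ∘ p∣ι⇒≡0 ]′
      (p∣x*y⇒p∣x⊎p∣y (+ 2) (ι y) (subst (+ p ∣_) (lemma (ι y)) (Equivalence.to (≡0−⇔p∣+ {y} {y}) y≡−y)))
      where lemma : ∀ y → y + y ≡ + 2 * y
            lemma = solve-∀

    rootCount : Fin p → ℤ
    rootCount k = count (λ x → ⌊ k FinP.≟ sq x ⌋)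

    rootCount-0 : rootCount 0ₚ ≡ + 1
    rootCount-0 = count≡1 0ₚ (fromWitness (sym sq-0)) (λ x t → sq≡0⇒≡0 (sym (toWitness t)))

    rootCount-QR : p ≢ 2 → ∀ {k} → InR p k → rootCount k ≡ + 2
    rootCount-QR p≢2 k∈R with Equivalence.to InR⇔ k∈R
    ... | k≢0 , y , refl = begin
      count (λ x → ⌊ sq y FinP.≟ sq x ⌋)                                   ≡⟨ sum-cong-≗ roots ⟩
      sum (λ x → 𝟙 ⌊ x FinP.≟ y ⌋ + 𝟙 ⌊ x FinP.≟ 0ₚ − y ⌋)                  ≡⟨ ∑-distrib-+ (λ x → 𝟙 ⌊ x FinP.≟ y ⌋) _ ⟩
      count (λ x → ⌊ x FinP.≟ y ⌋) + count (λ x → ⌊ x FinP.≟ 0ₚ − y ⌋)    ≡⟨ cong₂ _+_ (count-≟ y) (count-≟ (0ₚ − y)) ⟩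
      + 2                                                                   ∎
      where
      open ≡-Reasoning
      y≢0 : y ≢ 0ₚ
      y≢0 y≡0 = k≢0 (trans (cong sq y≡0) sq-0)
      roots : ∀ x → 𝟙 ⌊ sq y FinP.≟ sq x ⌋ ≡ 𝟙 ⌊ x FinP.≟ y ⌋ + 𝟙 ⌊ x FinP.≟ 0ₚ − y ⌋
      roots x with x FinP.≟ y | x FinP.≟ 0ₚ − y
      ... | yes refl | yes x≡−x = ⊥-elim (≢0⇒≢−self p≢2 y≢0 x≡−x)
      ... | yes refl | no  _    = 𝟙-T (fromWitness refl)
      ... | no  _    | yes refl = 𝟙-T (fromWitness (sym (sq-neg y)))
      ... | no  x≢y  | no  x≢−y = 𝟙-¬T (λ t → [ x≢y , x≢−y ]′ (sq≡sq⇒≡± (sym (toWitness t))))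

    rootCount-nonQR : ∀ {k} → k ≢ 0ₚ → ¬ InR p k → rootCount k ≡ + 0
    rootCount-nonQR k≢0 k∉R = count≡0 (λ x t → k∉R (Equivalence.from InR⇔ (k≢0 , x , sym (toWitness t))))

    rootCount≡2ρ+δ : p ≢ 2 → ∀ k → rootCount k ≡ + 2 * ρ p k + 𝟙 ⌊ k FinP.≟ 0ₚ ⌋
    rootCount≡2ρ+δ p≢2 k = by-zero k (k FinP.≟ 0ₚ)
      where
      by-residuosity : ∀ {k} → k ≢ 0ₚ → Dec (InR p k) → rootCount k ≡ + 2 * 𝟙 (isQR p k)
      by-residuosity k≢0 (yes k∈R) = trans (rootCount-QR p≢2 k∈R) (cong (+ 2 *_) (sym (𝟙-T k∈R)))
      by-residuosity k≢0 (no  k∉R) = trans (rootCount-nonQR k≢0 k∉R) (cong (+ 2 *_) (sym (𝟙-¬T k∉R)))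
      by-zero : ∀ k (d : Dec (k ≡ 0ₚ)) → rootCount k ≡ + 2 * ρ p k + 𝟙 ⌊ d ⌋
      by-zero .0ₚ (yes refl) = trans rootCount-0 (cong (λ r → + 2 * r + + 1) (sym ρ-0))
      by-zero k   (no k≢0)   = trans (by-residuosity k≢0 (BoolP.T? (isQR p k)))
        (sym (trans (cong (λ r → + 2 * r + + 0) (ρ≡𝟙∘isQR k)) (ℤP.+-identityʳ _)))

    sum-rootCount : sum rootCount ≡ + p
    sum-rootCount = begin
      sum (λ k → count (λ x → ⌊ k FinP.≟ sq x ⌋))    ≡⟨ ∑-comm (λ k x → 𝟙 ⌊ k FinP.≟ sq x ⌋) ⟩
      sum (λ x → count (λ k → ⌊ k FinP.≟ sq x ⌋))    ≡⟨ sum-cong-≗ (λ x → count-≟ (sq x)) ⟩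
      sum {p} (λ _ → + 1)                            ≡⟨ sum-const p (+ 1) ⟩
      + p * + 1                                      ≡⟨ ℤP.*-identityʳ (+ p) ⟩
      + p                                            ∎
      where open ≡-Reasoning

    2Σρ≡p-1 : p ≢ 2 → + 2 * sum (ρ p) ≡ + p - + 1
    2Σρ≡p-1 p≢2 = begin
      + 2 * sum (ρ p)                  ≡⟨ lemma (+ 2 * sum (ρ p)) ⟩
      + 2 * sum (ρ p) + + 1 - + 1      ≡⟨ cong (_- + 1) 2Σρ+1≡p ⟩
      + p - + 1                        ∎
      where
      open ≡-Reasoning
      lemma : ∀ x → x ≡ x + + 1 - + 1
      lemma = solve-∀
      2Σρ+1≡p : + 2 * sum (ρ p) + + 1 ≡ + p
      2Σρ+1≡p = begin
        + 2 * sum (ρ p) + + 1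
          ≡⟨ cong₂ _+_ (*-distribˡ-sum (+ 2) (ρ p)) (sym (count-≟ 0ₚ)) ⟩
        sum (λ k → + 2 * ρ p k) + count (λ k → ⌊ k FinP.≟ 0ₚ ⌋)
          ≡⟨ ∑-distrib-+ (λ k → + 2 * ρ p k) (λ k → 𝟙 ⌊ k FinP.≟ 0ₚ ⌋) ⟨
        sum (λ k → + 2 * ρ p k + 𝟙 ⌊ k FinP.≟ 0ₚ ⌋)
          ≡⟨ sum-cong-≗ (rootCount≡2ρ+δ p≢2) ⟨
        sum rootCount
          ≡⟨ sum-rootCount ⟩
        + p
          ∎

    DiffSetIsQR⇒NormTrace : p ≢ 2 → ∀ {A} → DiffSetIsQR p A →
      ∃[ n ] ((+ p ≡ + 2 * n * (n - + 1) + + 1) × ∃[ α ] (NormCondition n α × TraceCondition n α))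
    DiffSetIsQR⇒NormTrace p≢2 {A} A−A≐R =
      size A , P≡2n[n-1]+1 {size A} {sum (ρ p)} {+ p} n²≡n+Σρ (2Σρ≡p-1 p≢2) , χ A , norm , TraceCondition-χ A
      where
      N≡ : ∀ k → autocorrelation (χ A) k ≡ int𝒪 p (size A) k + ρ p k + + 0
      N≡ = DiffSetIsQR⇒autocorrelation≡size+ρ A−A≐R
      norm : NormCondition (size A) (χ A)
      norm = + 0 , λ k → trans (∣∣²≡autocorrelation (χ A) k) (N≡ k)
      n²≡n+Σρ : size A * size A ≡ size A + sum (ρ p)
      n²≡n+Σρ = trans (size²≡n+Σρ+pc A N≡)
                      (trans (cong (_+_ (size A + sum (ρ p))) (ℤP.*-zeroʳ (+ p))) (ℤP.+-identityʳ _))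

    NormCondition⇒DiffSetIsQR⊎size≡p-n : ∀ {n E} → + p ≡ + 2 * n * (n - + 1) + + 1 →
                     NormCondition n (χ E) → DiffSetIsQR p E ⊎ size E ≡ + p - n
    NormCondition⇒DiffSetIsQR⊎size≡p-n {n} {E} p≡ (c , ∣χ∣²≡) =
      Sum.map c≡0⇒DiffSetIsQR (trans (size≡n+c E N≡)) (c≡0⊎n+c≡P-n n c (+ p) [n+c]²≡)
      where
      N≡ : ∀ k → autocorrelation (χ E) k ≡ int𝒪 p n k + ρ p k + c
      N≡ k = trans (sym (∣∣²≡autocorrelation (χ E) k)) (∣χ∣²≡ k)
      p≢2 : p ≢ 2
      p≢2 p≡2 = 2n[n-1]+1≢2x n (+ 1) (trans (sym p≡) (cong +_ p≡2))
      Σρ≡n[n-1] : sum (ρ p) ≡ n * (n - + 1)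
      Σρ≡n[n-1] = ℤP.*-cancelˡ-≡ (+ 2) _ _ (trans (2Σρ≡p-1 p≢2) (trans (cong (_- + 1) p≡) (lemma n)))
        where lemma : ∀ n → (+ 2 * n * (n - + 1) + + 1) - + 1 ≡ + 2 * (n * (n - + 1))
              lemma = solve-∀
      [n+c]²≡ : (n + c) * (n + c) ≡ n + n * (n - + 1) + + p * c
      [n+c]²≡ = begin
        (n + c) * (n + c)                  ≡⟨ cong (λ m → m * m) (size≡n+c E N≡) ⟨
        size E * size E                    ≡⟨ size²≡n+Σρ+pc E N≡ ⟩
        n + sum (ρ p) + + p * c            ≡⟨ cong (λ s → n + s + + p * c) Σρ≡n[n-1] ⟩
        n + n * (n - + 1) + + p * c        ∎
        where open ≡-Reasoning
      c≡0⇒DiffSetIsQR : c ≡ + 0 → DiffSetIsQR p E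
      c≡0⇒DiffSetIsQR c≡0 = autocorrelation≡ρ⇒DiffSetIsQR λ k k≢0 → begin
        autocorrelation (χ E) k            ≡⟨ N≡ k ⟩
        int𝒪 p n k + ρ p k + c             ≡⟨ cong₂ (λ i r → i + ρ p k + r) (int𝒪-≢0 n k≢0) c≡0 ⟩
        + 0 + ρ p k + + 0                  ≡⟨ ℤP.+-identityʳ _ ⟩
        + 0 + ρ p k                        ≡⟨ ℤP.+-identityˡ (ρ p k) ⟩
        ρ p k                              ∎
        where open ≡-Reasoning

    DiffSetIsQR-or-complement : ∀ {n} E → + p ≡ + 2 * n * (n - + 1) + + 1 → NormCondition n (χ E) →
                                DiffSetIsQR p E ⊎ DiffSetIsQR p (∁ E)
    DiffSetIsQR-or-complement {n} E p≡ norm =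
      choose (NormCondition⇒DiffSetIsQR⊎size≡p-n {n} {E} p≡ norm)
             (NormCondition⇒DiffSetIsQR⊎size≡p-n {n} {∁ E} p≡ (NormCondition-∁ E norm))
      where
      choose : DiffSetIsQR p E ⊎ size E ≡ + p - n → DiffSetIsQR p (∁ E) ⊎ size (∁ E) ≡ + p - n →
               DiffSetIsQR p E ⊎ DiffSetIsQR p (∁ E)
      choose (inj₁ E-works)  _                 = inj₁ E-works
      choose (inj₂ _)        (inj₁ ∁E-works)   = inj₂ ∁E-works
      choose (inj₂ |E|≡p-n)  (inj₂ |∁E|≡p-n)   = ⊥-elim (2n[n-1]+1≢2x n n (trans (sym p≡) (begin
        + p                      ≡⟨ lemma (+ p) n ⟩
        (+ p - n) + n            ≡⟨ cong (_+ n) |∁E|≡p-n ⟨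
        size (∁ E) + n           ≡⟨ cong (_+ n) (trans (size-∁ E) (cong (_-_ (+ p)) |E|≡p-n)) ⟩
        (+ p - (+ p - n)) + n    ≡⟨ lemma′ (+ p) n ⟩
        + 2 * n                  ∎)))
        where open ≡-Reasoning
              lemma : ∀ P n → P ≡ (P - n) + n
              lemma = solve-∀
              lemma′ : ∀ P n → (P - (P - n)) + n ≡ + 2 * n
              lemma′ = solve-∀

    NormTrace⇒DiffSetIsQR : ∀ {n α} → + p ≡ + 2 * n * (n - + 1) + + 1 →
      NormCondition n α → TraceCondition n α → ∃[ A ] DiffSetIsQR p A
    NormTrace⇒DiffSetIsQR {n} {α} p≡ norm trace =
      [ (A ,_) , (∁ A ,_) ]′ (DiffSetIsQR-or-complement A p≡ normA)
      where
      A : Subset p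
      A = levelSet α n
      normA : NormCondition n (χ A)
      normA = ≈𝒪-trans {∣_∣² p (χ A)} {∣_∣² p α} {_+𝒪_ p (int𝒪 p n) (ρ p)}
                (∣∣²-cong {χ A} {α} (≈𝒪-sym {α} {χ A} (TraceCondition⇒≈χ trace))) norm

-- In 𝔽₂ the residue 1 is its own negative.
¬DiffSetIsQR₂ : ∀ {A} → ¬ DiffSetIsQR 2 A
¬DiffSetIsQR₂ A−A≐R = DiffSetIsQR⇒-r≢r 2 A−A≐R {Fin.suc Fin.zero} tt refl

propositionA1 : (p : ℕ) .{{_ : NonZero p}} → Prime p →
    (∃[ A ] DiffSetIsQR p A)
    ⇔ (∃[ n ] ((+ p ≡ + 2 * n * (n - + 1) + + 1)
         × ∃[ α ] ((_≈𝒪_ p (∣_∣² p α) (_+𝒪_ p (int𝒪 p n) (ρ p)))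
             × (∀ (k : ℤ) → (tr p (_*𝒪_ p α (ζ^ p (- k))) ≡ - n)
                            ⊎ (tr p (_*𝒪_ p α (ζ^ p (- k))) ≡ + p - n)))))
propositionA1 p p-prime =
  mk⇔ forward (λ (n , p≡ , α , norm , trace) → NormTrace⇒DiffSetIsQR p p-prime {n} {α} p≡ norm trace)
  where
  forward : ∃[ A ] DiffSetIsQR p A →
            ∃[ n ] ((+ p ≡ + 2 * n * (n - + 1) + + 1) × ∃[ α ] (NormCondition p n α × TraceCondition p n α))
  forward (A , A−A≐R) with p ℕ.≟ 2
  ... | yes refl = ⊥-elim (¬DiffSetIsQR₂ A−A≐R)
  ... | no  p≢2  = DiffSetIsQR⇒NormTrace p p-prime p≢2 A−A≐R
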